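{- For every natural number $k\ge1$ there exist a matrix $A_k\in\{0,1\}^{(2^k-1)\times(2k-1)}$ and a vector $c\in\mathbb{Z}^{2k-1}$ such that $A_kc=1^{2^k-1}$ (the all-ones vector), exactly one row of $A_k$ equals $(1,\dots,1)$, and every column of $A_k$ has Hamming weight in $[2^{k-1}-1,\,2^{k-1}+1]$. -}

module Defs where

open import Data.Nat using (ℕ; zero; suc; _+_)
open import Data.Bool using (Bool; true; false)
open import Data.Fin using (Fin)
open import Data.Integer using (ℤ; +_)
import Data.Integer as ℤ

BinMatrix : ℕ → ℕ → Set
BinMatrix m n = Fin m → Fin n → Bool

toℤ : Bool → ℤ
toℤ true  = + 1
toℤ false = + 0

toℕ : Bool → ℕ
toℕ true  = 1
toℕ false = 0

sumℤ : (n : ℕ) → (Fin n → ℤ) → ℤ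
sumℤ zero    f = + 0
sumℤ (suc n) f = f Fin.zero ℤ.+ sumℤ n (λ j → f (Fin.suc j))

sumℕ : (n : ℕ) → (Fin n → ℕ) → ℕ
sumℕ zero    f = 0
sumℕ (suc n) f = f Fin.zero + sumℕ n (λ j → f (Fin.suc j))

matVec : ∀ {m n} → BinMatrix m n → (Fin n → ℤ) → Fin m → ℤ
matVec {n = n} A c i = sumℤ n (λ j → toℤ (A i j) ℤ.* c j)

colWeight : ∀ {m n} → BinMatrix m n → Fin n → ℕ
colWeight {m = m} A j = sumℕ m (λ i → toℕ (A i j))

AllOnesRow : ∀ {m n} → BinMatrix m n → Fin m → Set
AllOnesRow A i = ∀ j → A i j ≡ true
  where open import Relation.Binary.PropositionalEquality using (_≡_)

-- Index the rows of A by m ∈ [1, 2^k) and write s for a bit position.  The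
-- columns are bit 0 of m (coefficient 1), bits s = 1 … k−1 of m (coefficient
-- 2^(s−1)) and bits s = 1 … k−1 of m − 1 (coefficient −2^(s−1)).  Row m then
-- computes (m mod 2) + ⌊m/2⌋ − ⌊(m−1)/2⌋, which is 1 for every m.  A column
-- reading bit s of m counts the numbers below 2^k with bit s set, namely
-- 2^(k−1); one reading bit s of m − 1 misses only 2^k − 1, so it has weight
-- 2^(k−1) − 1.  A row is all ones iff all k bits of m are set, i.e. m = 2^k − 1.
module Submission where

open import Defs
open import Data.Nat using (ℕ; _≤_; _^_; _∸_; _+_; _*_)
open import Data.Fin using (Fin)
open import Data.Integer using (ℤ; +_)
open import Data.Product using (Σ; _×_; ∃!)
open import Relation.Binary.PropositionalEquality using (_≡_)

open import Data.Nat using (zero; suc; _<_; z≤n; s≤s; z<s; _<?_; ⌊_/2⌋)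
import Data.Nat.Properties as ℕₚ
open import Data.Nat.Tactic.RingSolver using (solve-∀)
import Algebra.Properties.CommutativeSemigroup ℕₚ.*-commutativeSemigroup as ℕ*
open import Data.Bool using (Bool; true; false; not)
open import Data.Bool.Properties using (not-injective)
import Data.Fin as F
import Data.Fin.Properties as Fₚ
open import Data.Integer using (-_; _⊖_)
import Data.Integer as ℤ
import Data.Integer.Properties as ℤₚ
open import Data.Product using (_,_; proj₁; proj₂)
open import Data.Sum using (_⊎_; inj₁; inj₂)
open import Relation.Nullary using (yes; no)
open import Relation.Binary.PropositionalEquality
  using (refl; sym; trans; cong; cong₂; subst; module ≡-Reasoning)
open ≡-Reasoning

-- Sums over [0, n) of ℕ-indexed terms, so that matVec and colWeight of a
-- matrix tabulated from ℕ-indexed entries unfold to them.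
Σℕ : ℕ → (ℕ → ℕ) → ℕ
Σℕ n f = sumℕ n (λ i → f (F.toℕ i))

Σℤ : ℕ → (ℕ → ℤ) → ℤ
Σℤ n f = sumℤ n (λ i → f (F.toℕ i))

Σℕ-cong : ∀ n {f g : ℕ → ℕ} → (∀ i → f i ≡ g i) → Σℕ n f ≡ Σℕ n g
Σℕ-cong zero    eq = refl
Σℕ-cong (suc n) eq = cong₂ _+_ (eq 0) (Σℕ-cong n (λ i → eq (suc i)))

Σℕ-*ˡ : ∀ n c (f : ℕ → ℕ) → Σℕ n (λ i → c * f i) ≡ c * Σℕ n f
Σℕ-*ˡ zero    c f = sym (ℕₚ.*-zeroʳ c)
Σℕ-*ˡ (suc n) c f = trans (cong (_+_ (c * f 0)) (Σℕ-*ˡ n c (λ i → f (suc i))))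
                          (sym (ℕₚ.*-distribˡ-+ c (f 0) _))

Σℕ-last : ∀ n (f : ℕ → ℕ) → Σℕ (suc n) f ≡ Σℕ n f + f n
Σℕ-last zero    f = ℕₚ.+-comm (f 0) 0
Σℕ-last (suc n) f = trans (cong (_+_ (f 0)) (Σℕ-last n (λ i → f (suc i))))
                          (sym (ℕₚ.+-assoc (f 0) _ _))

Σℕ-double : ∀ n (f : ℕ → ℕ) → Σℕ (2 * n) (λ m → f ⌊ m /2⌋) ≡ 2 * Σℕ n f
Σℕ-double zero    f = refl
Σℕ-double (suc n) f = begin
  Σℕ (2 * suc n) (λ m → f ⌊ m /2⌋)
    ≡⟨ cong (λ r → Σℕ r (λ m → f ⌊ m /2⌋)) (ℕₚ.*-suc 2 n) ⟩
  f 0 + (f 0 + Σℕ (2 * n) (λ m → f (suc ⌊ m /2⌋)))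
    ≡⟨ cong (λ x → f 0 + (f 0 + x)) (Σℕ-double n (λ i → f (suc i))) ⟩
  f 0 + (f 0 + 2 * Σℕ n (λ i → f (suc i)))
    ≡⟨ a+[a+2b]≡2[a+b] (f 0) _ ⟩
  2 * Σℕ (suc n) f ∎
  where
  a+[a+2b]≡2[a+b] : ∀ a b → a + (a + 2 * b) ≡ 2 * (a + b)
  a+[a+2b]≡2[a+b] = solve-∀

Σℤ-cong : ∀ n {f g : ℕ → ℤ} → (∀ i → f i ≡ g i) → Σℤ n f ≡ Σℤ n g
Σℤ-cong zero    eq = refl
Σℤ-cong (suc n) eq = cong₂ ℤ._+_ (eq 0) (Σℤ-cong n (λ i → eq (suc i)))

Σℤ-pos : ∀ n (f : ℕ → ℕ) → Σℤ n (λ i → + f i) ≡ + Σℕ n f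
Σℤ-pos zero    f = refl
Σℤ-pos (suc n) f = trans (cong (ℤ._+_ (+ f 0)) (Σℤ-pos n (λ i → f (suc i))))
                         (sym (ℤₚ.pos-+ (f 0) _))

Σℤ-neg : ∀ n (f : ℕ → ℤ) → Σℤ n (λ i → - f i) ≡ - Σℤ n f
Σℤ-neg zero    f = refl
Σℤ-neg (suc n) f = trans (cong (ℤ._+_ (- f 0)) (Σℤ-neg n (λ i → f (suc i))))
                         (sym (ℤₚ.neg-distrib-+ (f 0) _))

splice : {A : Set} → ℕ → (ℕ → A) → (ℕ → A) → ℕ → A
splice zero    u v t       = v t
splice (suc k) u v zero    = u zero
splice (suc k) u v (suc t) = splice k (λ s → u (suc s)) v t

splice-< : ∀ {A : Set} k (u v : ℕ → A) {t} → t < k → splice k u v t ≡ u t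
splice-< (suc k) u v {zero}  _         = refl
splice-< (suc k) u v {suc t} (s≤s t<k) = splice-< k (λ s → u (suc s)) v t<k

splice-+ : ∀ {A : Set} k (u v : ℕ → A) s → splice k u v (k + s) ≡ v s
splice-+ zero    u v s = refl
splice-+ (suc k) u v s = splice-+ k (λ s → u (suc s)) v s

splice-zipWith : ∀ {A B C : Set} (h : A → B → C) k u v u′ v′ t →
  h (splice k u v t) (splice k u′ v′ t)
    ≡ splice k (λ s → h (u s) (u′ s)) (λ s → h (v s) (v′ s)) t
splice-zipWith h zero    u v u′ v′ t       = refl
splice-zipWith h (suc k) u v u′ v′ zero    = refl
splice-zipWith h (suc k) u v u′ v′ (suc t) =
  splice-zipWith h k (λ s → u (suc s)) v (λ s → u′ (suc s)) v′ t

Σℤ-splice : ∀ k b (u v : ℕ → ℤ) → Σℤ (k + b) (splice k u v) ≡ Σℤ k u ℤ.+ Σℤ b v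
Σℤ-splice zero    b u v = sym (ℤₚ.+-identityˡ _)
Σℤ-splice (suc k) b u v =
  trans (cong (ℤ._+_ (u 0)) (Σℤ-splice k b (λ s → u (suc s)) v))
        (sym (ℤₚ.+-assoc (u 0) _ _))

odd : ℕ → Bool
odd zero          = false
odd (suc zero)    = true
odd (suc (suc n)) = odd n

bit : ℕ → ℕ → Bool
bit zero    m = odd m
bit (suc s) m = bit s ⌊ m /2⌋

odd-suc : ∀ n → odd (suc n) ≡ not (odd n)
odd-suc zero          = refl
odd-suc (suc zero)    = refl
odd-suc (suc (suc n)) = odd-suc n

odd[2*n]≡false : ∀ n → odd (2 * n) ≡ false
odd[2*n]≡false zero = refl
odd[2*n]≡false (suc n) = trans (cong odd (ℕₚ.*-suc 2 n)) (odd[2*n]≡false n)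

⌊2*n/2⌋≡n : ∀ n → ⌊ 2 * n /2⌋ ≡ n
⌊2*n/2⌋≡n zero = refl
⌊2*n/2⌋≡n (suc n) = trans (cong ⌊_/2⌋ (ℕₚ.*-suc 2 n)) (cong suc (⌊2*n/2⌋≡n n))

toℕ-odd+2*⌊n/2⌋≡n : ∀ n → toℕ (odd n) + 2 * ⌊ n /2⌋ ≡ n
toℕ-odd+2*⌊n/2⌋≡n zero          = refl
toℕ-odd+2*⌊n/2⌋≡n (suc zero)    = refl
toℕ-odd+2*⌊n/2⌋≡n (suc (suc n)) =
  trans (a+2[1+b]≡2+[a+2b] (toℕ (odd n)) ⌊ n /2⌋) (cong (_+_ 2) (toℕ-odd+2*⌊n/2⌋≡n n))
  where
  a+2[1+b]≡2+[a+2b] : ∀ a b → a + 2 * suc b ≡ 2 + (a + 2 * b)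
  a+2[1+b]≡2+[a+2b] = solve-∀

toℕ-odd[1+n]+⌊1+n/2⌋≡1+⌊n/2⌋ : ∀ n → toℕ (odd (suc n)) + ⌊ suc n /2⌋ ≡ suc ⌊ n /2⌋
toℕ-odd[1+n]+⌊1+n/2⌋≡1+⌊n/2⌋ zero          = refl
toℕ-odd[1+n]+⌊1+n/2⌋≡1+⌊n/2⌋ (suc zero)    = refl
toℕ-odd[1+n]+⌊1+n/2⌋≡1+⌊n/2⌋ (suc (suc n)) =
  trans (ℕₚ.+-suc (toℕ (odd (suc n))) _) (cong suc (toℕ-odd[1+n]+⌊1+n/2⌋≡1+⌊n/2⌋ n))

odd[1+n]⇒⌊n/2⌋≡⌊1+n/2⌋ : ∀ n → odd (suc n) ≡ true → ⌊ n /2⌋ ≡ ⌊ suc n /2⌋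
odd[1+n]⇒⌊n/2⌋≡⌊1+n/2⌋ zero          _   = refl
odd[1+n]⇒⌊n/2⌋≡⌊1+n/2⌋ (suc (suc n)) odd = cong suc (odd[1+n]⇒⌊n/2⌋≡⌊1+n/2⌋ n odd)

⌊m/2⌋<n : ∀ {m n} → m < 2 * n → ⌊ m /2⌋ < n
⌊m/2⌋<n {m} m<2n = ℕₚ.*-cancelˡ-< 2 _ _ (ℕₚ.≤-<-trans 2⌊m/2⌋≤m m<2n)
  where
  2⌊m/2⌋≤m : 2 * ⌊ m /2⌋ ≤ m
  2⌊m/2⌋≤m = subst (2 * ⌊ m /2⌋ ≤_) (toℕ-odd+2*⌊n/2⌋≡n m) (ℕₚ.m≤n+m _ (toℕ (odd m)))

1+n≡2*x⇒odd : ∀ {n x} → suc n ≡ 2 * x → odd n ≡ true × suc ⌊ n /2⌋ ≡ x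
1+n≡2*x⇒odd {n} {x} eq = not-injective (trans (sym (odd-suc n)) odd[1+n]≡false) , half
  where
  odd[1+n]≡false : odd (suc n) ≡ false
  odd[1+n]≡false = trans (cong odd eq) (odd[2*n]≡false x)
  half : suc ⌊ n /2⌋ ≡ x
  half = begin
    suc ⌊ n /2⌋                         ≡⟨ toℕ-odd[1+n]+⌊1+n/2⌋≡1+⌊n/2⌋ n ⟨
    toℕ (odd (suc n)) + ⌊ suc n /2⌋     ≡⟨ cong (λ y → toℕ (odd y) + ⌊ y /2⌋) eq ⟩
    toℕ (odd (2 * x)) + ⌊ 2 * x /2⌋     ≡⟨ cong₂ _+_ (cong toℕ (odd[2*n]≡false x)) (⌊2*n/2⌋≡n x) ⟩
    x                                   ∎

bit-0 : ∀ s → bit s 0 ≡ false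
bit-0 zero    = refl
bit-0 (suc s) = bit-0 s

1+m≡2^k⇒bit≡true : ∀ {k m} → suc m ≡ 2 ^ k → ∀ {s} → s < k → bit s m ≡ true
1+m≡2^k⇒bit≡true {suc k} eq {zero}  _         = proj₁ (1+n≡2*x⇒odd {x = 2 ^ k} eq)
1+m≡2^k⇒bit≡true {suc k} eq {suc s} (s≤s s<k) =
  1+m≡2^k⇒bit≡true (proj₂ (1+n≡2*x⇒odd {x = 2 ^ k} eq)) s<k

bit≡true⇒1+m≡2^k : ∀ k {m} → m < 2 ^ k → (∀ s → s < k → bit s m ≡ true) → suc m ≡ 2 ^ k
bit≡true⇒1+m≡2^k zero    {zero}  _          _    = refl
bit≡true⇒1+m≡2^k zero    {suc m} (s≤s ())   _
bit≡true⇒1+m≡2^k (suc k) {m}     m<2^[1+k] ones = begin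
  suc m                            ≡⟨ cong suc (toℕ-odd+2*⌊n/2⌋≡n m) ⟨
  suc (toℕ (odd m) + 2 * ⌊ m /2⌋)  ≡⟨ cong (λ b → suc (toℕ b + 2 * ⌊ m /2⌋)) (ones 0 z<s) ⟩
  2 + 2 * ⌊ m /2⌋                  ≡⟨ ℕₚ.*-suc 2 _ ⟨
  2 * suc ⌊ m /2⌋                  ≡⟨ cong (2 *_) (bit≡true⇒1+m≡2^k k (⌊m/2⌋<n m<2^[1+k])
                                                     (λ s s<k → ones (suc s) (s≤s s<k))) ⟩
  2 * 2 ^ k                        ∎

binary-expansion : ∀ k {m} → m < 2 ^ k → Σℕ k (λ s → toℕ (bit s m) * 2 ^ s) ≡ m
binary-expansion zero    {zero}  _        = refl
binary-expansion zero    {suc m} (s≤s ())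
binary-expansion (suc k) {m}     m<2^[1+k] = begin
  toℕ (odd m) * 1 + Σℕ k (λ s → toℕ (bit s ⌊ m /2⌋) * (2 * 2 ^ s))
    ≡⟨ cong₂ _+_ (ℕₚ.*-identityʳ _) (Σℕ-cong k (λ s → ℕ*.x∙yz≈y∙xz (toℕ (bit s ⌊ m /2⌋)) 2 (2 ^ s))) ⟩
  toℕ (odd m) + Σℕ k (λ s → 2 * (toℕ (bit s ⌊ m /2⌋) * 2 ^ s))
    ≡⟨ cong (_+_ (toℕ (odd m))) (Σℕ-*ˡ k 2 (λ s → toℕ (bit s ⌊ m /2⌋) * 2 ^ s)) ⟩
  toℕ (odd m) + 2 * Σℕ k (λ s → toℕ (bit s ⌊ m /2⌋) * 2 ^ s)
    ≡⟨ cong (λ x → toℕ (odd m) + 2 * x) (binary-expansion k (⌊m/2⌋<n m<2^[1+k])) ⟩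
  toℕ (odd m) + 2 * ⌊ m /2⌋
    ≡⟨ toℕ-odd+2*⌊n/2⌋≡n m ⟩
  m ∎

toℤ-* : ∀ b n → toℤ b ℤ.* + n ≡ + (toℕ b * n)
toℤ-* true  n = sym (ℤₚ.pos-* 1 n)
toℤ-* false n = refl

Σℤ-binary-expansion : ∀ k {m} → m < 2 ^ k → Σℤ k (λ s → toℤ (bit s m) ℤ.* + (2 ^ s)) ≡ + m
Σℤ-binary-expansion k {m} m<2^k = begin
  Σℤ k (λ s → toℤ (bit s m) ℤ.* + (2 ^ s))  ≡⟨ Σℤ-cong k (λ s → toℤ-* (bit s m) (2 ^ s)) ⟩
  Σℤ k (λ s → + (toℕ (bit s m) * 2 ^ s))    ≡⟨ Σℤ-pos k (λ s → toℕ (bit s m) * 2 ^ s) ⟩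
  + Σℕ k (λ s → toℕ (bit s m) * 2 ^ s)      ≡⟨ cong +_ (binary-expansion k m<2^k) ⟩
  + m                                       ∎

Σℤ-negated-binary-expansion : ∀ k {m} → m < 2 ^ k →
  Σℤ k (λ s → toℤ (bit s m) ℤ.* - + (2 ^ s)) ≡ - + m
Σℤ-negated-binary-expansion k {m} m<2^k = begin
  Σℤ k (λ s → toℤ (bit s m) ℤ.* - + (2 ^ s))
    ≡⟨ Σℤ-cong k (λ s → ℤₚ.neg-distribʳ-* (toℤ (bit s m)) (+ (2 ^ s))) ⟨
  Σℤ k (λ s → - (toℤ (bit s m) ℤ.* + (2 ^ s)))
    ≡⟨ Σℤ-neg k (λ s → toℤ (bit s m) ℤ.* + (2 ^ s)) ⟩
  - Σℤ k (λ s → toℤ (bit s m) ℤ.* + (2 ^ s))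
    ≡⟨ cong -_ (Σℤ-binary-expansion k m<2^k) ⟩
  - + m ∎

count-bit : ∀ {s k} → s ≤ k → Σℕ (2 ^ suc k) (λ m → toℕ (bit s m)) ≡ 2 ^ k
count-bit {k = k} z≤n = Σℕ-odd (2 ^ k)
  where
  Σℕ-odd : ∀ n → Σℕ (2 * n) (λ m → toℕ (odd m)) ≡ n
  Σℕ-odd zero = refl
  Σℕ-odd (suc n) =
    trans (cong (λ r → Σℕ r (λ m → toℕ (odd m))) (ℕₚ.*-suc 2 n)) (cong suc (Σℕ-odd n))
count-bit {suc s} {suc k} (s≤s s≤k) =
  trans (Σℕ-double (2 ^ suc k) (λ m → toℕ (bit s m))) (cong (2 *_) (count-bit s≤k))

1+[2^k∸1]≡2^k : ∀ k → suc (2 ^ k ∸ 1) ≡ 2 ^ k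
1+[2^k∸1]≡2^k k = ℕₚ.m+[n∸m]≡n (ℕₚ.m^n>0 2 k)

count-bit-from-1 : ∀ {s k} → s ≤ k → Σℕ (2 ^ suc k ∸ 1) (λ n → toℕ (bit s (suc n))) ≡ 2 ^ k
count-bit-from-1 {s} {k} s≤k = begin
  Σℕ (2 ^ suc k ∸ 1) (λ n → toℕ (bit s (suc n)))
    ≡⟨ cong (λ b → toℕ b + Σℕ (2 ^ suc k ∸ 1) (λ n → toℕ (bit s (suc n)))) (bit-0 s) ⟨
  Σℕ (suc (2 ^ suc k ∸ 1)) (λ m → toℕ (bit s m))
    ≡⟨ cong (λ r → Σℕ r (λ m → toℕ (bit s m))) (1+[2^k∸1]≡2^k (suc k)) ⟩
  Σℕ (2 ^ suc k) (λ m → toℕ (bit s m))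
    ≡⟨ count-bit s≤k ⟩
  2 ^ k ∎

count-bit-below-top : ∀ {s k} → s ≤ k → Σℕ (2 ^ suc k ∸ 1) (λ n → toℕ (bit s n)) ≡ 2 ^ k ∸ 1
count-bit-below-top {s} {k} s≤k = begin
  Σℕ last b              ≡⟨ ℕₚ.m+n∸n≡m _ 1 ⟨
  Σℕ last b + 1 ∸ 1      ≡⟨ cong (λ x → Σℕ last b + toℕ x ∸ 1) last-bit ⟨
  Σℕ last b + b last ∸ 1 ≡⟨ cong (_∸ 1) (Σℕ-last last b) ⟨
  Σℕ (suc last) b ∸ 1    ≡⟨ cong (λ r → Σℕ r b ∸ 1) (1+[2^k∸1]≡2^k (suc k)) ⟩
  Σℕ (2 ^ suc k) b ∸ 1   ≡⟨ cong (_∸ 1) (count-bit s≤k) ⟩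
  2 ^ k ∸ 1              ∎
  where
  last : ℕ
  last = 2 ^ suc k ∸ 1
  b : ℕ → ℕ
  b m = toℕ (bit s m)
  last-bit : bit s last ≡ true
  last-bit = 1+m≡2^k⇒bit≡true (1+[2^k∸1]≡2^k (suc k)) (s≤s s≤k)

a+b≡1+c⇒a+[b-c]≡1 : ∀ {a b c} → a + b ≡ suc c → + a ℤ.+ (+ b ℤ.- + c) ≡ + 1
a+b≡1+c⇒a+[b-c]≡1 {a} {b} {c} eq = begin
  + a ℤ.+ (+ b ℤ.- + c)  ≡⟨ ℤₚ.+-assoc (+ a) (+ b) (- + c) ⟨
  + a ℤ.+ + b ℤ.- + c    ≡⟨ cong (ℤ._- + c) (ℤₚ.pos-+ a b) ⟨
  + (a + b) ℤ.- + c      ≡⟨ cong (λ x → + x ℤ.- + c) eq ⟩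
  + suc c ℤ.- + c        ≡⟨ ℤₚ.m-n≡m⊖n (suc c) c ⟩
  suc c ⊖ c              ≡⟨ ℤₚ.⊖-≥ (ℕₚ.n≤1+n c) ⟩
  + (suc c ∸ c)          ≡⟨ cong +_ (ℕₚ.m+n∸n≡m 1 c) ⟩
  + 1                    ∎

≡⊎≡∸1⇒within-1 : ∀ {w x} → w ≡ x ⊎ w ≡ x ∸ 1 → x ∸ 1 ≤ w × w ≤ x + 1
≡⊎≡∸1⇒within-1 {x = x} (inj₁ refl) = ℕₚ.m∸n≤m x 1 , ℕₚ.m≤m+n x 1
≡⊎≡∸1⇒within-1 {x = x} (inj₂ refl) = ℕₚ.≤-refl , ℕₚ.≤-trans (ℕₚ.m∸n≤m x 1) (ℕₚ.m≤m+n x 1)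

∃!-toℕ : ∀ {m r} (P : ℕ → Set) → r < m → P r → (∀ {n} → n < m → P n → n ≡ r) →
  ∃! _≡_ (λ (i : Fin m) → P (F.toℕ i))
∃!-toℕ P r<m Pr unique =
  F.fromℕ< r<m ,
  subst P (sym (Fₚ.toℕ-fromℕ< r<m)) Pr ,
  λ {i} Pi → Fₚ.toℕ-injective (trans (Fₚ.toℕ-fromℕ< r<m) (sym (unique (Fₚ.toℕ<n i) Pi)))

-- The paper's A_{k+1}; row n stands for m = n + 1.
module Construction (k : ℕ) where

  rows columns : ℕ
  rows    = 2 ^ suc k ∸ 1
  columns = 2 * suc k ∸ 1

  entry : ℕ → ℕ → Bool
  entry n zero    = bit 0 (suc n)
  entry n (suc t) = splice k (λ s → bit (suc s) (suc n)) (λ s → bit (suc s) n) t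

  coeff : ℕ → ℤ
  coeff zero    = + 1
  coeff (suc t) = splice k (λ s → + (2 ^ s)) (λ s → - + (2 ^ s)) t

  columns≡1+k+k : columns ≡ suc (k + k)
  columns≡1+k+k = trans (ℕₚ.+-suc k (k + 0)) (cong (λ x → suc (k + x)) (ℕₚ.+-identityʳ k))

  data Column : ℕ → Set where
    parity   : Column 0
    bit-of-m : ∀ {s} → s < k → Column (suc s)
    bit-of-n : ∀ {s} → s < k → Column (suc (k + s))

  column : ∀ {t} → t < columns → Column t
  column {t} t<columns = view t (subst (t <_) columns≡1+k+k t<columns)
    where
    view : ∀ t → t < suc (k + k) → Column t
    view zero    _          = parity
    view (suc t) (s≤s t<2k) with t <? k
    ... | yes t<k = bit-of-m t<k
    ... | no  t≮k = subst Column (cong suc k+[t∸k]≡t) (bit-of-n t∸k<k)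
      where
      k+[t∸k]≡t : k + (t ∸ k) ≡ t
      k+[t∸k]≡t = ℕₚ.m+[n∸m]≡n (ℕₚ.≮⇒≥ t≮k)
      t∸k<k : t ∸ k < k
      t∸k<k = ℕₚ.+-cancelˡ-< k _ _ (subst (_< k + k) (sym k+[t∸k]≡t) t<2k)

  bit-of-m<columns : ∀ {s} → s < k → suc s < columns
  bit-of-m<columns {s} s<k =
    subst (suc s <_) (sym columns≡1+k+k) (s≤s (ℕₚ.≤-trans s<k (ℕₚ.m≤m+n k k)))

  entry-bit-of-m : ∀ n {s} → s < k → entry n (suc s) ≡ bit (suc s) (suc n)
  entry-bit-of-m n = splice-< k (λ s → bit (suc s) (suc n)) (λ s → bit (suc s) n)

  entry-bit-of-n : ∀ n s → entry n (suc (k + s)) ≡ bit (suc s) n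
  entry-bit-of-n n = splice-+ k (λ s → bit (suc s) (suc n)) (λ s → bit (suc s) n)

  1+n<2^[1+k] : ∀ {n} → n < rows → suc n < 2 ^ suc k
  1+n<2^[1+k] {n} n<rows = subst (suc n <_) (1+[2^k∸1]≡2^k (suc k)) (s≤s n<rows)

  row-sum : ∀ {n} → n < rows → Σℤ columns (λ t → toℤ (entry n t) ℤ.* coeff t) ≡ + 1
  row-sum {n} n<rows = begin
    Σℤ columns term
      ≡⟨ cong (λ c → Σℤ c term) columns≡1+k+k ⟩
    term 0 ℤ.+ Σℤ (k + k) (λ t → term (suc t))
      ≡⟨ cong (ℤ._+_ (term 0)) (Σℤ-cong (k + k) (splice-zipWith (λ b z → toℤ b ℤ.* z) k _ _ _ _)) ⟩
    term 0 ℤ.+ Σℤ (k + k) (splice k m-term n-term)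
      ≡⟨ cong (ℤ._+_ (term 0)) (Σℤ-splice k k m-term n-term) ⟩
    term 0 ℤ.+ (Σℤ k m-term ℤ.+ Σℤ k n-term)
      ≡⟨ cong₂ (λ x y → x ℤ.+ (y ℤ.+ Σℤ k n-term))
               (toℤ-* (odd (suc n)) 1) (Σℤ-binary-expansion k (⌊m/2⌋<n (1+n<2^[1+k] n<rows))) ⟩
    + (toℕ (odd (suc n)) * 1) ℤ.+ (+ ⌊ suc n /2⌋ ℤ.+ Σℤ k n-term)
      ≡⟨ cong (λ x → + (toℕ (odd (suc n)) * 1) ℤ.+ (+ ⌊ suc n /2⌋ ℤ.+ x))
              (Σℤ-negated-binary-expansion k (⌊m/2⌋<n (ℕₚ.<-trans (ℕₚ.n<1+n n) (1+n<2^[1+k] n<rows)))) ⟩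
    + (toℕ (odd (suc n)) * 1) ℤ.+ (+ ⌊ suc n /2⌋ ℤ.- + ⌊ n /2⌋)
      ≡⟨ a+b≡1+c⇒a+[b-c]≡1 (trans (cong (_+ ⌊ suc n /2⌋) (ℕₚ.*-identityʳ _))
                                  (toℕ-odd[1+n]+⌊1+n/2⌋≡1+⌊n/2⌋ n)) ⟩
    + 1 ∎
    where
    term : ℕ → ℤ
    term t = toℤ (entry n t) ℤ.* coeff t
    m-term n-term : ℕ → ℤ
    m-term s = toℤ (bit (suc s) (suc n)) ℤ.* + (2 ^ s)
    n-term s = toℤ (bit (suc s) n) ℤ.* - + (2 ^ s)

  column-weight : ∀ {t} → Column t →
    Σℕ rows (λ n → toℕ (entry n t)) ≡ 2 ^ k ⊎ Σℕ rows (λ n → toℕ (entry n t)) ≡ 2 ^ k ∸ 1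
  column-weight parity = inj₁ (count-bit-from-1 {k = k} z≤n)
  column-weight (bit-of-m s<k) =
    inj₁ (trans (Σℕ-cong rows (λ n → cong toℕ (entry-bit-of-m n s<k))) (count-bit-from-1 s<k))
  column-weight (bit-of-n {s} s<k) =
    inj₂ (trans (Σℕ-cong rows (λ n → cong toℕ (entry-bit-of-n n s))) (count-bit-below-top s<k))

  AllOnes : ℕ → Set
  AllOnes n = ∀ (j : Fin columns) → entry n (F.toℕ j) ≡ true

  top : ℕ
  top = 2 ^ suc k ∸ 2

  2+top≡2^[1+k] : suc (suc top) ≡ 2 ^ suc k
  2+top≡2^[1+k] = ℕₚ.m+[n∸m]≡n (ℕₚ.*-monoʳ-≤ 2 (ℕₚ.m^n>0 2 k))

  top<rows : top < rows
  top<rows = subst (top <_) (cong (_∸ 1) 2+top≡2^[1+k]) (ℕₚ.n<1+n top)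

  top-all-ones : AllOnes top
  top-all-ones j = top-entry (column (Fₚ.toℕ<n j))
    where
    top-bit : ∀ {s} → s < suc k → bit s (suc top) ≡ true
    top-bit = 1+m≡2^k⇒bit≡true 2+top≡2^[1+k]
    top-entry : ∀ {t} → Column t → entry top t ≡ true
    top-entry parity             = top-bit z<s
    top-entry (bit-of-m s<k)     = trans (entry-bit-of-m top s<k) (top-bit (s≤s s<k))
    top-entry (bit-of-n {s} s<k) =
      trans (entry-bit-of-n top s)
        (trans (cong (bit s) (odd[1+n]⇒⌊n/2⌋≡⌊1+n/2⌋ top (top-bit z<s))) (top-bit (s≤s s<k)))

  all-ones⇒top : ∀ {n} → n < rows → AllOnes n → n ≡ top
  all-ones⇒top {n} n<rows ones =
    ℕₚ.suc-injective (ℕₚ.suc-injective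
      (trans (bit≡true⇒1+m≡2^k (suc k) (1+n<2^[1+k] n<rows) bits) (sym 2+top≡2^[1+k])))
    where
    entry≡true : ∀ {t} → t < columns → entry n t ≡ true
    entry≡true t<columns =
      subst (λ t → entry n t ≡ true) (Fₚ.toℕ-fromℕ< t<columns) (ones (F.fromℕ< t<columns))
    bits : ∀ s → s < suc k → bit s (suc n) ≡ true
    bits zero    _         = entry≡true (subst (0 <_) (sym columns≡1+k+k) z<s)
    bits (suc s) (s≤s s<k) = trans (sym (entry-bit-of-m n s<k)) (entry≡true (bit-of-m<columns s<k))

lemma3p6 : (k : ℕ) → 1 ≤ k →
    Σ (BinMatrix (2 ^ k ∸ 1) (2 * k ∸ 1)) λ A →
    Σ (Fin (2 * k ∸ 1) → ℤ) λ c →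
    (∀ i → matVec A c i ≡ + 1)
    × ∃! _≡_ (λ i → AllOnesRow A i)
    × (∀ j → (2 ^ (k ∸ 1) ∸ 1 ≤ colWeight A j) × (colWeight A j ≤ 2 ^ (k ∸ 1) + 1))
lemma3p6 zero    ()
lemma3p6 (suc k) _ =
  A , c ,
  (λ i → row-sum (Fₚ.toℕ<n i)) ,
  ∃!-toℕ AllOnes top<rows top-all-ones all-ones⇒top ,
  (λ j → ≡⊎≡∸1⇒within-1 (column-weight (column (Fₚ.toℕ<n j))))
  where
  open Construction k
  A : BinMatrix rows columns
  A i j = entry (F.toℕ i) (F.toℕ j)
  c : Fin columns → ℤ
  c j = coeff (F.toℕ j)
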